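{- For any finite simple graphs $G$ and $H$ without vertices of degree 0 and each of order at least three, $$\gamma_{tR}(G\times H)\ge \max\left\{\frac{\rho_o(H)\gamma_{tR}(G)}{2},\ \frac{\rho_o(G)\gamma_{tR}(H)}{2}\right\}.$$
   Context: An open packing of $G$ is a set $D\subseteq V(G)$ with $N(u)\cap N(v)=\emptyset$ for all distinct $u,v\in D$ ($N(\cdot)$ the open neighborhood); $\rho_o(G)$ is the maximum size of an open packing. A function $f:V(G)\to\{0,1,2\}$ with $V_i=f^{ -1}(i)$ is a total Roman dominating function if every vertex in $V_0$ has a neighbor in $V_2$ and the subgraph induced by $V_1\cup V_2$ has no isolated vertices; $\gamma_{tR}(G)$ is the minimum of $\sum_v f(v)$ over such $f$. The direct product $G\times H$ has vertex set $V(G)\times V(H)$, with $(g,h)(g',h')$ an edge iff $gg'\in E(G)$ and $hh'\in E(H)$. -}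

module Defs where

open import Data.Nat using (ℕ; zero; suc; _+_; _*_; _≤_)
open import Data.Fin using (Fin; toℕ; remQuot)
import Data.Fin as F
open import Data.Bool using (Bool; true; false; _∧_)
open import Data.Product using (Σ; _×_; _,_; ∃; proj₁; proj₂)
open import Relation.Binary.PropositionalEquality using (_≡_; _≢_)
open import Relation.Nullary using (¬_)

record Graph : Set where
  field
    n      : ℕ
    adj    : Fin n → Fin n → Bool
    sym    : ∀ u v → adj u v ≡ adj v u
    irrefl : ∀ v → adj v v ≡ false
open Graph public

Adj : (G : Graph) → Fin (n G) → Fin (n G) → Set
Adj G u v = adj G u v ≡ true

order : Graph → ℕ
order G = n G

NoIsolated : Graph → Set
NoIsolated G = ∀ v → ∃ λ u → Adj G v u

sumFin : (k : ℕ) → (Fin k → ℕ) → ℕ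
sumFin zero    f = 0
sumFin (suc k) f = f F.zero + sumFin k (λ i → f (F.suc i))

card : {k : ℕ} → (Fin k → Bool) → ℕ
card {k} D = sumFin k (λ i → if D i then 1 else 0)
  where open import Data.Bool using (if_then_else_)

IsOpenPacking : (G : Graph) → (Fin (n G) → Bool) → Set
IsOpenPacking G D =
  ∀ u v → u ≢ v → D u ≡ true → D v ≡ true →
  ∀ w → ¬ (Adj G u w × Adj G v w)

IsOpenPackingNumber : Graph → ℕ → Set
IsOpenPackingNumber G r =
  (Σ (Fin (n G) → Bool) λ D → IsOpenPacking G D × card D ≡ r) ×
  (∀ D → IsOpenPacking G D → card D ≤ r)

IsTRDF : (G : Graph) → (Fin (n G) → Fin 3) → Set
IsTRDF G f =
  (∀ v → toℕ (f v) ≡ 0 → ∃ λ u → Adj G v u × toℕ (f u) ≡ 2) ×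
  (∀ v → toℕ (f v) ≢ 0 → ∃ λ u → Adj G v u × toℕ (f u) ≢ 0)

weight : (G : Graph) → (Fin (n G) → Fin 3) → ℕ
weight G f = sumFin (n G) (λ v → toℕ (f v))

IsTRDNumber : Graph → ℕ → Set
IsTRDNumber G t =
  (Σ (Fin (n G) → Fin 3) λ f → IsTRDF G f × weight G f ≡ t) ×
  (∀ f → IsTRDF G f → t ≤ weight G f)

direct : Graph → Graph → Graph
direct G H = record
  { n = n G * n H
  ; adj = λ k k' → adjP (remQuot (n H) k) (remQuot (n H) k')
  ; sym = λ k k' → symP (remQuot (n H) k) (remQuot (n H) k')
  ; irrefl = λ k → irrP (remQuot (n H) k)
  }
  where
  adjP : Fin (n G) × Fin (n H) → Fin (n G) × Fin (n H) → Bool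
  adjP (g , h) (g' , h') = adj G g g' ∧ adj H h h'
  symP : ∀ p q → adjP p q ≡ adjP q p
  symP (g , h) (g' , h') rewrite sym G g g' | sym H h h' = Relation.Binary.PropositionalEquality.refl
  irrP : ∀ p → adjP p p ≡ false
  irrP (g , h) rewrite irrefl G g = Relation.Binary.PropositionalEquality.refl

module Submission where

-- Fix a minimum total Roman dominating function f of G × H and an
-- open packing D of H.  For a vertex h of H let s_h(g) be the f-weight of the
-- fibre {g} × N(h).  Labelling g by 2 when s_h(g) > 0 and by 0 otherwise is a
-- total Roman dominating function of G: every (g, h) has a neighbour
-- (g', h') with f(g', h') > 0, so g' is a neighbour of g with s_h(g') > 0.
-- Hence γ_tR(G) ≤ 2·Σ_g s_h(g) for every h.  Summing over h ∈ D and using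
-- that the neighbourhoods N(h), h ∈ D, are pairwise disjoint, every value
-- f(g, h') is counted at most once, so |D|·γ_tR(G) ≤ 2·w(f).

open import Defs
open import Data.Nat using (ℕ; _≤_; _*_; _⊔_)
open import Data.Nat.Base using (zero; suc; _+_; z≤n; s≤s)
open import Data.Nat.Properties
  using ( +-*-semiring; +-mono-≤; +-assoc; +-identityʳ; *-assoc; *-comm; *-identityˡ
        ; *-monoʳ-≤; *-monoˡ-≤; ≤-trans; ≤-reflexive; m≤m+n; n≢0⇒n>0; _≟_; ⊔-lub; module ≤-Reasoning)
open import Data.Fin as F using (Fin; toℕ; remQuot; combine; _↑ˡ_; _↑ʳ_)
open import Data.Fin.Properties using (remQuot-combine; combine-remQuot; suc-injective)
  renaming (_≟_ to _≟F_)
open import Data.Bool using (Bool; true; false; _∧_; if_then_else_)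
open import Data.Product using (_×_; _,_; ∃; proj₁; proj₂)
open import Relation.Binary.PropositionalEquality
  using (_≡_; _≢_; refl; cong; subst; trans)
  renaming (sym to ≡-sym)
open import Relation.Nullary using (yes; no)
open import Data.Empty using (⊥-elim)
open import Algebra.Properties.Semiring.Sum +-*-semiring
  using (sum; sum-cong-≗; sum-remove; ∑-comm; *-distribˡ-sum; *-distribʳ-sum)

sumFin≡sum : ∀ k (f : Fin k → ℕ) → sumFin k f ≡ sum f
sumFin≡sum zero    f = refl
sumFin≡sum (suc k) f = cong (f F.zero +_) (sumFin≡sum k (λ i → f (F.suc i)))

sum-mono : ∀ {k} {f g : Fin k → ℕ} → (∀ i → f i ≤ g i) → sum f ≤ sum g
sum-mono {zero}  f≤g = z≤n
sum-mono {suc k} f≤g = +-mono-≤ (f≤g F.zero) (sum-mono (λ i → f≤g (F.suc i)))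

term≤sum : ∀ {k} (f : Fin k → ℕ) i → f i ≤ sum f
term≤sum {suc k} f i = ≤-trans (m≤m+n (f i) _) (≤-reflexive (≡-sym (sum-remove {i = i} f)))

sum-++ : ∀ m n (f : Fin (m + n) → ℕ) →
  sum f ≡ sum (λ i → f (i ↑ˡ n)) + sum (λ j → f (m ↑ʳ j))
sum-++ zero    n f = refl
sum-++ (suc m) n f =
  trans (cong (f F.zero +_) (sum-++ m n (λ i → f (F.suc i)))) (≡-sym (+-assoc (f F.zero) _ _))

sum-combine : ∀ m n (f : Fin (m * n) → ℕ) →
  sum f ≡ sum (λ i → sum (λ j → f (combine {m} {n} i j)))
sum-combine zero    n f = refl
sum-combine (suc m) n f =
  trans (sum-++ n (m * n) f) (cong (sum (λ j → f (j ↑ˡ (m * n))) +_) (sum-combine m n _))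

χ : Bool → ℕ
χ b = if b then 1 else 0

χ-∧ : ∀ a b x → χ a * (χ b * x) ≡ χ (a ∧ b) * x
χ-∧ false b x = refl
χ-∧ true  b x = +-identityʳ (χ b * x)

sum-χ-false : ∀ {k} (P : Fin k → Bool) → (∀ i → P i ≡ false) → sum (λ i → χ (P i)) ≡ 0
sum-χ-false {zero}  P none = refl
sum-χ-false {suc k} P none rewrite none F.zero = sum-χ-false (λ i → P (F.suc i)) (λ i → none (F.suc i))

sum-χ-atMostOne : ∀ {k} (P : Fin k → Bool) →
  (∀ u v → P u ≡ true → P v ≡ true → u ≡ v) → sum (λ i → χ (P i)) ≤ 1
sum-χ-atMostOne {zero}  P unique = z≤n
sum-χ-atMostOne {suc k} P unique with P F.zero in P0
... | true  = ≤-reflexive (cong suc (sum-χ-false (λ i → P (F.suc i)) onlyZero))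
  where
  onlyZero : ∀ i → P (F.suc i) ≡ false
  onlyZero i with P (F.suc i) in Pi
  ... | false = refl
  ... | true with unique F.zero (F.suc i) P0 Pi
  ...   | ()
... | false = sum-χ-atMostOne (λ i → P (F.suc i))
                (λ u v Pu Pv → suc-injective (unique (F.suc u) (F.suc v) Pu Pv))

∧-true : ∀ {a b} → a ∧ b ≡ true → (a ≡ true) × (b ≡ true)
∧-true {true} {true} refl = refl , refl

record ProductView (G H P : Graph) : Set where
  field
    pair        : Fin (n G) → Fin (n H) → Fin (n P)
    fst         : Fin (n P) → Fin (n G)
    snd         : Fin (n P) → Fin (n H)
    pair-fst-snd : ∀ p → pair (fst p) (snd p) ≡ p
    adj-proj    : ∀ g h q → Adj P (pair g h) q → Adj G g (fst q) × Adj H h (snd q)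
    sum-pair    : ∀ (w : Fin (n P) → ℕ) → sum w ≡ sum (λ g → sum (λ h → w (pair g h)))

direct-adj-remQuot : ∀ G H p q → Adj (direct G H) p q →
  Adj G (proj₁ (remQuot {n G} (n H) p)) (proj₁ (remQuot {n G} (n H) q)) ×
  Adj H (proj₂ (remQuot {n G} (n H) p)) (proj₂ (remQuot {n G} (n H) q))
direct-adj-remQuot G H p q a with remQuot {n G} (n H) p | remQuot {n G} (n H) q
... | (g , h) | (g' , h') = ∧-true a

direct-adj : ∀ G H g h q → Adj (direct G H) (combine {n G} {n H} g h) q →
  Adj G g (proj₁ (remQuot {n G} (n H) q)) × Adj H h (proj₂ (remQuot {n G} (n H) q))
direct-adj G H g h q a =
  subst (λ (gh : Fin (n G) × Fin (n H)) → Adj G (proj₁ gh) _ × Adj H (proj₂ gh) _)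
        (remQuot-combine {n G} {n H} g h)
        (direct-adj-remQuot G H (combine g h) q a)

direct-view : ∀ G H → ProductView G H (direct G H)
direct-view G H = record
  { pair         = combine
  ; fst          = λ p → proj₁ (remQuot {n G} (n H) p)
  ; snd          = λ p → proj₂ (remQuot {n G} (n H) p)
  ; pair-fst-snd = combine-remQuot {n G} (n H)
  ; adj-proj     = direct-adj G H
  ; sum-pair     = sum-combine (n G) (n H)
  }

direct-view-swapped : ∀ G H → ProductView H G (direct G H)
direct-view-swapped G H = record
  { pair         = λ h g → combine g h
  ; fst          = λ p → proj₂ (remQuot {n G} (n H) p)
  ; snd          = λ p → proj₁ (remQuot {n G} (n H) p)
  ; pair-fst-snd = combine-remQuot {n G} (n H)
  ; adj-proj     = λ h g q a → let (aG , aH) = direct-adj G H g h q a in aH , aG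
  ; sum-pair     = λ w → trans (sum-combine (n G) (n H) w) (∑-comm (λ g h → w (combine {n G} {n H} g h)))
  }

≡2⇒≢0 : ∀ {x} → x ≡ 2 → x ≢ 0
≡2⇒≢0 refl ()

positive-neighbour : ∀ G f → IsTRDF G f → ∀ v → ∃ λ u → Adj G v u × toℕ (f u) ≢ 0
positive-neighbour G f (dominated , notIsolated) v with toℕ (f v) ≟ 0
... | no  fv≢0 = notIsolated v fv≢0
... | yes fv≡0 with dominated v fv≡0
...   | u , vu , fu≡2 = u , vu , ≡2⇒≢0 fu≡2

dominated-by-twos : ∀ G ℓ → (∀ v → ∃ λ u → Adj G v u × toℕ (ℓ u) ≡ 2) → IsTRDF G ℓ
dominated-by-twos G ℓ twoNbr = (λ v _ → twoNbr v) , positive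
  where
  positive : ∀ v → toℕ (ℓ v) ≢ 0 → ∃ λ u → Adj G v u × toℕ (ℓ u) ≢ 0
  positive v _ with twoNbr v
  ... | u , vu , ℓu≡2 = u , vu , ≡2⇒≢0 ℓu≡2

twoIfPositive : ℕ → Fin 3
twoIfPositive zero    = F.zero
twoIfPositive (suc _) = F.suc (F.suc F.zero)

twoIfPositive-pos : ∀ x → 1 ≤ x → toℕ (twoIfPositive x) ≡ 2
twoIfPositive-pos (suc x) _ = refl

twoIfPositive-≤ : ∀ x → toℕ (twoIfPositive x) ≤ 2 * x
twoIfPositive-≤ zero    = z≤n
twoIfPositive-≤ (suc x) = *-monoʳ-≤ 2 (s≤s (z≤n {x}))

nbrSum : (H : Graph) → Fin (n H) → (Fin (n H) → ℕ) → ℕ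
nbrSum H h w = sum (λ h' → χ (adj H h h') * w h')

projection-bound : ∀ {G H P} → (V : ProductView G H P) → ∀ {tG} → IsTRDNumber G tG →
  ∀ f → IsTRDF P f → ∀ h →
  tG ≤ 2 * sum (λ g → nbrSum H h (λ h' → toℕ (f (ProductView.pair V g h'))))
projection-bound {G} {H} {P} V {tG} (_ , minimal) f trdf h =
  begin
    tG                                  ≤⟨ minimal ℓ (dominated-by-twos G ℓ twoNbr) ⟩
    weight G ℓ                          ≡⟨ sumFin≡sum (n G) (λ g → toℕ (ℓ g)) ⟩
    sum (λ g → toℕ (twoIfPositive (s g))) ≤⟨ sum-mono (λ g → twoIfPositive-≤ (s g)) ⟩
    sum (λ g → 2 * s g)                 ≡⟨ ≡-sym (*-distribˡ-sum 2 s) ⟩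
    2 * sum s                           ∎
  where
  open ProductView V
  open ≤-Reasoning
  s : Fin (n G) → ℕ
  s g = nbrSum H h (λ h' → toℕ (f (pair g h')))
  ℓ : Fin (n G) → Fin 3
  ℓ g = twoIfPositive (s g)
  -- A positive neighbour q of (g, h) contributes f(q) > 0 to s(fst q).
  twoNbr : ∀ g → ∃ λ g' → Adj G g g' × toℕ (ℓ g') ≡ 2
  twoNbr g with positive-neighbour P f trdf (pair g h)
  ... | q , a , fq≢0 with adj-proj g h q a
  ...   | gg' , hh' = fst q , gg' ,
          twoIfPositive-pos (s (fst q)) (≤-trans contribution (term≤sum _ (snd q)))
    where
    contribution : 1 ≤ χ (adj H h (snd q)) * toℕ (f (pair (fst q) (snd q)))
    contribution rewrite hh' | +-identityʳ (toℕ (f (pair (fst q) (snd q)))) | pair-fst-snd q =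
      n≢0⇒n>0 fq≢0

-- Packing step: the open neighbourhoods of an open packing D are disjoint, so
-- summing the neighbourhood weights over D counts every vertex at most once.
packing-nbrSum : ∀ H D → IsOpenPacking H D → ∀ (w : Fin (n H) → ℕ) →
  sum (λ h → χ (D h) * nbrSum H h w) ≤ sum w
packing-nbrSum H D packing w =
  begin
    sum (λ h → χ (D h) * nbrSum H h w)
      ≡⟨ sum-cong-≗ (λ h → *-distribˡ-sum (χ (D h)) (λ h' → χ (adj H h h') * w h')) ⟩
    sum (λ h → sum (λ h' → χ (D h) * (χ (adj H h h') * w h')))
      ≡⟨ ∑-comm (λ h h' → χ (D h) * (χ (adj H h h') * w h')) ⟩
    sum (λ h' → sum (λ h → χ (D h) * (χ (adj H h h') * w h')))
      ≡⟨ sum-cong-≗ (λ h' → sum-cong-≗ (λ h → χ-∧ (D h) (adj H h h') (w h'))) ⟩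
    sum (λ h' → sum (λ h → χ (D h ∧ adj H h h') * w h'))
      ≡⟨ sum-cong-≗ (λ h' → ≡-sym (*-distribʳ-sum (w h') (λ h → χ (D h ∧ adj H h h')))) ⟩
    sum (λ h' → sum (λ h → χ (D h ∧ adj H h h')) * w h')
      ≤⟨ sum-mono (λ h' → *-monoˡ-≤ (w h') (sum-χ-atMostOne _ (atMostOneIn h'))) ⟩
    sum (λ h' → 1 * w h')
      ≡⟨ sum-cong-≗ (λ h' → *-identityˡ (w h')) ⟩
    sum w ∎
  where
  open ≤-Reasoning
  atMostOneIn : ∀ h' u v → D u ∧ adj H u h' ≡ true → D v ∧ adj H v h' ≡ true → u ≡ v
  atMostOneIn h' u v Pu Pv with u ≟F v
  ... | yes u≡v = u≡v
  ... | no  u≢v =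
    let (Du , uh') = ∧-true Pu ; (Dv , vh') = ∧-true Pv
    in ⊥-elim (packing u v u≢v Du Dv h' (uh' , vh'))

packing-bound : ∀ {G H P} → ProductView G H P → ∀ {tG t rH} →
  IsTRDNumber G tG → IsTRDNumber P t → IsOpenPackingNumber H rH → rH * tG ≤ 2 * t
packing-bound {G} {H} {P} V {tG} {t} {rH} TG ((f , trdf , wf≡t) , _) ((D , packing , cardD≡rH) , _) =
  begin
    rH * tG                                          ≡⟨ cong (_* tG) (≡-sym cardD≡rH) ⟩
    card D * tG                                      ≡⟨ cong (_* tG) (sumFin≡sum (n H) (λ h → χ (D h))) ⟩
    sum (λ h → χ (D h)) * tG                         ≡⟨ *-distribʳ-sum tG (λ h → χ (D h)) ⟩
    sum (λ h → χ (D h) * tG)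
      ≤⟨ sum-mono (λ h → *-monoʳ-≤ (χ (D h)) (projection-bound V TG f trdf h)) ⟩
    sum (λ h → χ (D h) * (2 * S h))                  ≡⟨ sum-cong-≗ (λ h → x*[y*z]≡y*[x*z] (χ (D h)) 2 (S h)) ⟩
    sum (λ h → 2 * (χ (D h) * S h))                  ≡⟨ ≡-sym (*-distribˡ-sum 2 (λ h → χ (D h) * S h)) ⟩
    2 * sum (λ h → χ (D h) * S h)
      ≡⟨ cong (2 *_) (sum-cong-≗ (λ h → *-distribˡ-sum (χ (D h)) (λ g → nbrSum H h (w g)))) ⟩
    2 * sum (λ h → sum (λ g → χ (D h) * nbrSum H h (w g)))
      ≡⟨ cong (2 *_) (∑-comm (λ h g → χ (D h) * nbrSum H h (w g))) ⟩
    2 * sum (λ g → sum (λ h → χ (D h) * nbrSum H h (w g)))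
      ≤⟨ *-monoʳ-≤ 2 (sum-mono (λ g → packing-nbrSum H D packing (w g))) ⟩
    2 * sum (λ g → sum (w g))                        ≡⟨ cong (2 *_) (≡-sym (sum-pair (λ p → toℕ (f p)))) ⟩
    2 * sum (λ p → toℕ (f p))                        ≡⟨ cong (2 *_) (≡-sym (sumFin≡sum (n P) (λ p → toℕ (f p)))) ⟩
    2 * weight P f                                   ≡⟨ cong (2 *_) wf≡t ⟩
    2 * t ∎
  where
  open ProductView V
  open ≤-Reasoning
  w : Fin (n G) → Fin (n H) → ℕ
  w g h' = toℕ (f (pair g h'))
  S : Fin (n H) → ℕ
  S h = sum (λ g → nbrSum H h (w g))
  x*[y*z]≡y*[x*z] : ∀ x y z → x * (y * z) ≡ y * (x * z)
  x*[y*z]≡y*[x*z] x y z = trans (≡-sym (*-assoc x y z))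
    (trans (cong (_* z) (*-comm x y)) (*-assoc y x z))

theorem8 : (G H : Graph) → NoIsolated G → NoIsolated H →
    3 ≤ order G → 3 ≤ order H →
    (tG tH tGH rG rH : ℕ) →
    IsTRDNumber G tG → IsTRDNumber H tH → IsTRDNumber (direct G H) tGH →
    IsOpenPackingNumber G rG → IsOpenPackingNumber H rH →
    (rH * tG) ⊔ (rG * tH) ≤ 2 * tGH
theorem8 G H _ _ _ _ tG tH tGH rG rH TG TH TGH RG RH =
  ⊔-lub (packing-bound (direct-view G H) TG TGH RH)
        (packing-bound (direct-view-swapped G H) TH TGH RG)
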